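{- Let $\mathcal{F}$ be a finite family of finite sets and $X$ a finite set such that $\mathcal{F}\langle X \rangle \neq \emptyset$. Then \[\mu(\{F \setminus X : F \in \mathcal{F}\langle X \rangle\}) \geq \mu(\mathcal{F}) - |X|.\]
   Context: For a family $\mathcal{F}$ and a set $X$, $\mathcal{F}\langle X\rangle := \{F \in \mathcal{F} : X \subseteq F\}$. A base of a family $\mathcal{G}$ is a set $B \in \mathcal{G}$ that is not a proper subset of any member of $\mathcal{G}$; $\mu(\mathcal{G})$ denotes the size of a smallest base of $\mathcal{G}$. -}

module Defs where

open import Data.Nat using (ℕ; zero; suc; _⊓_)
open import Data.Fin using (Fin)
open import Data.Fin.Subset using (Subset; _⊆_; _⊂_; _∈_; _∉_; _─_; ∣_∣)
open import Data.Fin.Subset.Properties using (_⊆?_; _∈?_)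
open import Data.Fin.Properties using (any?)
open import Data.List using (List; []; _∷_; filter; map)
open import Data.List.Relation.Unary.All using (All; all?)
open import Data.List.Membership.Propositional using () renaming (_∈_ to _∈ₗ_)
open import Data.Product using (_×_; _,_; ∃)
open import Relation.Nullary using (¬_; Dec; yes; no; ¬?)
open import Relation.Nullary.Decidable using (_×-dec_)

Family : ℕ → Set
Family n = List (Subset n)

_⊂?_ : ∀ {n} (p q : Subset n) → Dec (p ⊂ q)
p ⊂? q = (p ⊆? q) ×-dec any? (λ x → (x ∈? q) ×-dec ¬? (x ∈? p))

_⟨_⟩ : ∀ {n} → Family n → Subset n → Family n
𝓕 ⟨ X ⟩ = filter (λ F → X ⊆? F) 𝓕

_∖ᶠ_ : ∀ {n} → Family n → Subset n → Family n
𝓖 ∖ᶠ X = map (λ F → F ─ X) 𝓖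

IsBase : ∀ {n} → Family n → Subset n → Set
IsBase 𝓖 B = (B ∈ₗ 𝓖) × All (λ G → ¬ (B ⊂ G)) 𝓖

bases : ∀ {n} → Family n → Family n
bases 𝓖 = filter (λ B → all? (λ G → ¬? (B ⊂? G)) 𝓖) 𝓖

-- minimum of a list of naturals (0 for the empty list; only used on nonempty lists)
minimum : List ℕ → ℕ
minimum []           = 0
minimum (x ∷ [])     = x
minimum (x ∷ y ∷ xs) = x ⊓ minimum (y ∷ xs)

μ : ∀ {n} → Family n → ℕ
μ 𝓖 = minimum (map ∣_∣ (bases 𝓖))

module Submission where

-- Let 𝓖 = {F ∖ X : F ∈ 𝓕⟨X⟩}.  Since 𝓖 is nonempty it has a
-- base, so μ(𝓖) is attained: some base B of 𝓖 has |B| = μ(𝓖).  Write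
-- B = F ∖ X with F ∈ 𝓕 and X ⊆ F.  Then F is a base of 𝓕: a proper
-- superset G ∈ 𝓕 of F also contains X, and G ∖ X ∈ 𝓖 would properly
-- contain F ∖ X (the new element of G lies outside F ⊇ X).  Hence
--   μ(𝓕) ≤ |F| ≤ |F ∖ X| + |X| = μ(𝓖) + |X|.

open import Defs
open import Data.Nat using (ℕ; _≤_; _+_; z≤n; s≤s)
open import Data.Nat.Properties
  using (≤-refl; ≤-trans; ≤-reflexive; <-irrefl; <-≤-trans; ⊓-sel; m⊓n≤m; m⊓n≤n;
         n≤1+n; +-monoʳ-≤; +-suc; ≤-totalOrder; module ≤-Reasoning)
open import Data.Fin using (Fin; zero; suc)
open import Data.Fin.Subset using (Subset; ∣_∣; _⊆_; _⊂_; _─_; _∈_; _∉_; inside; outside)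
open import Data.Fin.Subset.Properties using (p⊂q⇒∣p∣<∣q∣; _⊆?_)
open import Data.Vec.Base using ([]; _∷_; here; there)
open import Data.List using (List; []; _∷_; map)
open import Data.List.Relation.Unary.Any using (here; there)
open import Data.List.Relation.Unary.All as All using (All; all?; tabulate; _∷_)
open import Data.List.Membership.Propositional using () renaming (_∈_ to _∈ₗ_)
open import Data.List.Membership.Propositional.Properties
  using (∈-map⁺; ∈-map⁻; ∈-filter⁺; ∈-filter⁻)
open import Data.List.Extrema ≤-totalOrder using (argmax; argmax-sel; f[⊥]≤f[argmax]; f[xs]≤f[argmax])
open import Data.Product using (_×_; _,_; ∃; proj₁)
open import Data.Sum using (inj₁; inj₂)
open import Relation.Nullary using (¬?)
open import Relation.Binary.PropositionalEquality using (_≡_; _≢_; refl; sym; subst; cong)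

minimum-≤ : ∀ {x} (xs : List ℕ) → x ∈ₗ xs → minimum xs ≤ x
minimum-≤ (x ∷ [])     (here refl) = ≤-refl
minimum-≤ (x ∷ y ∷ xs) (here refl) = m⊓n≤m x _
minimum-≤ (x ∷ y ∷ xs) (there x∈)  = ≤-trans (m⊓n≤n x _) (minimum-≤ (y ∷ xs) x∈)

minimum-∈ : (xs : List ℕ) → xs ≢ [] → minimum xs ∈ₗ xs
minimum-∈ []       xs≢[] with () ← xs≢[] refl
minimum-∈ (x ∷ xs) _     = minimum-∷-∈ x xs
  where
  minimum-∷-∈ : ∀ x xs → minimum (x ∷ xs) ∈ₗ x ∷ xs
  minimum-∷-∈ x []       = here refl
  minimum-∷-∈ x (y ∷ xs) with ⊓-sel x (minimum (y ∷ xs))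
  ... | inj₁ eq = subst (_∈ₗ x ∷ y ∷ xs) (sym eq) (here refl)
  ... | inj₂ eq = subst (_∈ₗ x ∷ y ∷ xs) (sym eq) (there (minimum-∷-∈ y xs))

∈⇒≢[] : ∀ {A : Set} {x : A} {xs : List A} → x ∈ₗ xs → xs ≢ []
∈⇒≢[] (here _)  ()
∈⇒≢[] (there _) ()

map-≢[] : ∀ {A B : Set} (f : A → B) {xs : List A} → xs ≢ [] → map f xs ≢ []
map-≢[] f {[]}    xs≢[] = λ _ → xs≢[] refl
map-≢[] f {_ ∷ _} _     = λ ()

∈─⁻ : ∀ {n} {x : Fin n} (p q : Subset n) → x ∈ p ─ q → x ∈ p × x ∉ q
∈─⁻ {x = zero}  (inside ∷ p) (outside ∷ q) here       = here , λ ()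
∈─⁻ {x = suc x} (_ ∷ p)      (_ ∷ q)       (there x∈) with ∈─⁻ p q x∈
... | x∈p , x∉q = there x∈p , λ { (there x∈q) → x∉q x∈q }

∈─⁺ : ∀ {n} {x : Fin n} (p q : Subset n) → x ∈ p → x ∉ q → x ∈ p ─ q
∈─⁺ (inside ∷ p) (outside ∷ q) here        x∉q = here
∈─⁺ (inside ∷ p) (inside ∷ q)  here        x∉q with () ← x∉q here
∈─⁺ (_ ∷ p)      (_ ∷ q)       (there x∈p) x∉q = there (∈─⁺ p q x∈p (λ x∈q → x∉q (there x∈q)))

∣p∣≤∣p─q∣+∣q∣ : ∀ {n} (p q : Subset n) → ∣ p ∣ ≤ ∣ p ─ q ∣ + ∣ q ∣
∣p∣≤∣p─q∣+∣q∣ []            []            = z≤n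
∣p∣≤∣p─q∣+∣q∣ (outside ∷ p) (outside ∷ q) = ∣p∣≤∣p─q∣+∣q∣ p q
∣p∣≤∣p─q∣+∣q∣ (outside ∷ p) (inside ∷ q)  =
  ≤-trans (∣p∣≤∣p─q∣+∣q∣ p q) (+-monoʳ-≤ ∣ p ─ q ∣ (n≤1+n ∣ q ∣))
∣p∣≤∣p─q∣+∣q∣ (inside ∷ p)  (outside ∷ q) = s≤s (∣p∣≤∣p─q∣+∣q∣ p q)
∣p∣≤∣p─q∣+∣q∣ (inside ∷ p)  (inside ∷ q)  =
  ≤-trans (s≤s (∣p∣≤∣p─q∣+∣q∣ p q)) (≤-reflexive (sym (+-suc ∣ p ─ q ∣ ∣ q ∣)))

-- Removing a common part q ⊆ p preserves a proper inclusion p ⊂ r: the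
-- element of r outside p is also outside q.
─-mono-⊂ : ∀ {n} {p q r : Subset n} → q ⊆ p → p ⊂ r → p ─ q ⊂ r ─ q
─-mono-⊂ {p = p} {q} {r} q⊆p (p⊆r , y , y∈r , y∉p) =
    shrink
  , y , ∈─⁺ r q y∈r (λ y∈q → y∉p (q⊆p y∈q)) , (λ y∈p─q → y∉p (proj₁ (∈─⁻ p q y∈p─q)))
  where
  shrink : p ─ q ⊆ r ─ q
  shrink x∈ with ∈─⁻ p q x∈
  ... | x∈p , x∉q = ∈─⁺ r q (p⊆r x∈p) x∉q

bases⁺ : ∀ {n} {𝓖 : Family n} {B : Subset n} → IsBase 𝓖 B → B ∈ₗ bases 𝓖
bases⁺ {𝓖 = 𝓖} (B∈𝓖 , maximal) = ∈-filter⁺ (λ B → all? (λ G → ¬? (B ⊂? G)) 𝓖) B∈𝓖 maximal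

bases⁻ : ∀ {n} {𝓖 : Family n} {B : Subset n} → B ∈ₗ bases 𝓖 → IsBase 𝓖 B
bases⁻ {𝓖 = 𝓖} = ∈-filter⁻ (λ B → all? (λ G → ¬? (B ⊂? G)) 𝓖)

max-size⇒base : ∀ {n} {𝓖 : Family n} {B : Subset n} →
                B ∈ₗ 𝓖 → All (λ G → ∣ G ∣ ≤ ∣ B ∣) 𝓖 → IsBase 𝓖 B
max-size⇒base B∈𝓖 sizes =
  B∈𝓖 , All.map (λ ∣G∣≤∣B∣ B⊂G → <-irrefl refl (<-≤-trans (p⊂q⇒∣p∣<∣q∣ B⊂G) ∣G∣≤∣B∣)) sizes

base-exists : ∀ {n} (𝓖 : Family n) → 𝓖 ≢ [] → ∃ (IsBase 𝓖)
base-exists []      𝓖≢[] with () ← 𝓖≢[] refl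
base-exists (G ∷ 𝓖) _    = B , max-size⇒base B∈ B-largest
  where
  B : Subset _
  B = argmax ∣_∣ G 𝓖
  B∈ : B ∈ₗ G ∷ 𝓖
  B∈ with argmax-sel ∣_∣ G 𝓖
  ... | inj₁ B≡G = subst (_∈ₗ G ∷ 𝓖) (sym B≡G) (here refl)
  ... | inj₂ B∈𝓖 = there B∈𝓖
  B-largest : All (λ G′ → ∣ G′ ∣ ≤ ∣ B ∣) (G ∷ 𝓖)
  B-largest = f[⊥]≤f[argmax] {f = ∣_∣} G 𝓖 ∷ f[xs]≤f[argmax] {f = ∣_∣} G 𝓖

μ≤∣base∣ : ∀ {n} {𝓖 : Family n} {B : Subset n} → IsBase 𝓖 B → μ 𝓖 ≤ ∣ B ∣
μ≤∣base∣ {𝓖 = 𝓖} B-base = minimum-≤ (map ∣_∣ (bases 𝓖)) (∈-map⁺ ∣_∣ (bases⁺ B-base))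

μ-attained : ∀ {n} (𝓖 : Family n) → 𝓖 ≢ [] → ∃ λ B → IsBase 𝓖 B × ∣ B ∣ ≡ μ 𝓖
μ-attained 𝓖 𝓖≢[]
  with B₀ , B₀-base ← base-exists 𝓖 𝓖≢[]
  with B , B∈bases , μ≡∣B∣ ← ∈-map⁻ ∣_∣ (minimum-∈ (map ∣_∣ (bases 𝓖))
                                   (map-≢[] ∣_∣ (∈⇒≢[] (bases⁺ B₀-base))))
  = B , bases⁻ B∈bases , sym μ≡∣B∣

∈-restrict⁺ : ∀ {n} {𝓕 : Family n} {X F : Subset n} →
              F ∈ₗ 𝓕 → X ⊆ F → F ─ X ∈ₗ (𝓕 ⟨ X ⟩) ∖ᶠ X
∈-restrict⁺ {X = X} F∈𝓕 X⊆F = ∈-map⁺ (_─ X) (∈-filter⁺ (X ⊆?_) F∈𝓕 X⊆F)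

∈-restrict⁻ : ∀ {n} {𝓕 : Family n} {X B : Subset n} →
              B ∈ₗ (𝓕 ⟨ X ⟩) ∖ᶠ X → ∃ λ F → F ∈ₗ 𝓕 × X ⊆ F × B ≡ F ─ X
∈-restrict⁻ {𝓕 = 𝓕} {X} B∈ with ∈-map⁻ (_─ X) B∈
... | F , F∈𝓕⟨X⟩ , B≡F─X with ∈-filter⁻ (X ⊆?_) {xs = 𝓕} F∈𝓕⟨X⟩
... | F∈𝓕 , X⊆F = F , F∈𝓕 , X⊆F , B≡F─X

base-lift : ∀ {n} {𝓕 : Family n} {X F : Subset n} → F ∈ₗ 𝓕 → X ⊆ F →
            IsBase ((𝓕 ⟨ X ⟩) ∖ᶠ X) (F ─ X) → IsBase 𝓕 F
base-lift F∈𝓕 X⊆F (_ , maximal) = F∈𝓕 , tabulate λ G∈𝓕 F⊂G →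
  All.lookup maximal (∈-restrict⁺ G∈𝓕 (λ x∈X → proj₁ F⊂G (X⊆F x∈X))) (─-mono-⊂ X⊆F F⊂G)

lemma4p2 : ∀ {n} (𝓕 : Family n) (X : Subset n) → 𝓕 ⟨ X ⟩ ≢ []
           → μ 𝓕 ≤ μ ((𝓕 ⟨ X ⟩) ∖ᶠ X) + ∣ X ∣
lemma4p2 𝓕 X 𝓕⟨X⟩≢[]
  with B , B-base , ∣B∣≡μ ← μ-attained ((𝓕 ⟨ X ⟩) ∖ᶠ X) (map-≢[] (_─ X) 𝓕⟨X⟩≢[])
  with F , F∈𝓕 , X⊆F , refl ← ∈-restrict⁻ {𝓕 = 𝓕} (proj₁ B-base) = begin
    μ 𝓕                            ≤⟨ μ≤∣base∣ (base-lift F∈𝓕 X⊆F B-base) ⟩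
    ∣ F ∣                          ≤⟨ ∣p∣≤∣p─q∣+∣q∣ F X ⟩
    ∣ F ─ X ∣ + ∣ X ∣              ≡⟨ cong (_+ ∣ X ∣) ∣B∣≡μ ⟩
    μ ((𝓕 ⟨ X ⟩) ∖ᶠ X) + ∣ X ∣     ∎
  where open ≤-Reasoning
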